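{- The class of all srl-monoids, regarded as algebras $(A,\wedge,\vee,\cdot,\rightarrow,e)$ of type $(2,2,2,2,0)$, is a variety (i.e., it is equationally definable).
   Context: A commutative l-monoid is an algebra $(A,\wedge,\vee,\cdot,e)$ of type $(2,2,2,0)$ such that $(A,\wedge,\vee)$ is a lattice, $(A,\cdot,e)$ is a commutative monoid and $(a\vee b)\cdot c=(a\cdot c)\vee(b\cdot c)$ for all $a,b,c\in A$. An algebra $(A,\wedge,\vee,\cdot,\rightarrow,e)$ of type $(2,2,2,2,0)$ is an srl-monoid if $(A,\wedge,\vee,\cdot,e)$ is a commutative l-monoid and there is a subalgebra $Q$ of $(A,\wedge,\vee,\cdot,e)$ such that for all $a,b\in A$ the set $\{q\in Q: a\cdot q\leq b\}$ has a maximum and $a\rightarrow b$ equals this maximum. -}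

module Defs where

open import Level using (Level; 0ℓ)
open import Data.Nat using (ℕ)
open import Data.Product using (Σ; _×_)
open import Relation.Binary.PropositionalEquality using (_≡_)
import Algebra.Lattice.Structures as LS
import Algebra.Structures as AS

record Alg : Set₁ where
  field
    Carrier : Set
    _⊓_ _⊔_ _·_ _⇒_ : Carrier → Carrier → Carrier
    e : Carrier

module _ (A : Alg) where
  open Alg A

  _≤_ : Carrier → Carrier → Set
  a ≤ b = (a ⊓ b) ≡ a

  record IsCommLMonoid : Set where
    field
      isLattice : LS.IsLattice _≡_ _⊔_ _⊓_
      isCommMonoid : AS.IsCommutativeMonoid _≡_ _·_ e
      distrib : ∀ a b c → ((a ⊔ b) · c) ≡ ((a · c) ⊔ (b · c))

  record IsSubalgebra (Q : Carrier → Set) : Set where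
    field
      ⊓-closed : ∀ {a b} → Q a → Q b → Q (a ⊓ b)
      ⊔-closed : ∀ {a b} → Q a → Q b → Q (a ⊔ b)
      ·-closed : ∀ {a b} → Q a → Q b → Q (a · b)
      e-closed : Q e

  IsMaxResidual : (Q : Carrier → Set) → Carrier → Carrier → Set
  IsMaxResidual Q a b =
    Q (a ⇒ b) × ((a · (a ⇒ b)) ≤ b) × (∀ q → Q q → (a · q) ≤ b → q ≤ (a ⇒ b))

  IsSrlMonoid : Set₁
  IsSrlMonoid = IsCommLMonoid ×
    Σ (Carrier → Set) (λ Q → IsSubalgebra Q × (∀ a b → IsMaxResidual Q a b))

data Term : Set where
  var : ℕ → Term
  _∧ₜ_ _∨ₜ_ _·ₜ_ _→ₜ_ : Term → Term → Term
  eₜ : Term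

⟦_⟧ : Term → (A : Alg) → (ℕ → Alg.Carrier A) → Alg.Carrier A
⟦ var n ⟧ A ρ = ρ n
⟦ s ∧ₜ t ⟧ A ρ = Alg._⊓_ A (⟦ s ⟧ A ρ) (⟦ t ⟧ A ρ)
⟦ s ∨ₜ t ⟧ A ρ = Alg._⊔_ A (⟦ s ⟧ A ρ) (⟦ t ⟧ A ρ)
⟦ s ·ₜ t ⟧ A ρ = Alg._·_ A (⟦ s ⟧ A ρ) (⟦ t ⟧ A ρ)
⟦ s →ₜ t ⟧ A ρ = Alg._⇒_ A (⟦ s ⟧ A ρ) (⟦ t ⟧ A ρ)
⟦ eₜ ⟧ A ρ = Alg.e A

-- A satisfies the set of equations E (E s t means "s ≈ t" belongs to E)
Satisfies : Alg → (Term → Term → Set) → Set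
Satisfies A E = ∀ s t → E s t → ∀ (ρ : ℕ → Alg.Carrier A) → ⟦ s ⟧ A ρ ≡ ⟦ t ⟧ A ρ

IsVariety : (Alg → Set₁) → Set₁
IsVariety K = Σ (Term → Term → Set) (λ E →
  ∀ (A : Alg) → (K A → Satisfies A E) × (Satisfies A E → K A))

{-# OPTIONS --safe #-}
module Submission where

-- The subalgebra Q of an srl-monoid is not extra data: it is the set of
-- fixed points of σ x = e → x.  Indeed e · (e → q) ≤ q, and for q ∈ Q also
-- e · q ≤ q gives q ≤ e → q; conversely e → x always lies in Q.  So the
-- existence of Q becomes equations saying that the residuals are σ-fixed and
-- that σ-fixed points are closed under ∧, ∨, ·, e.  Maximality of x → y
-- among {q ∈ Q : x · q ≤ y} splits into two inequations: σ z ≤ x → x · σ z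
-- and monotonicity x → (y ∧ z) ≤ x → z; together they give, for a σ-fixed q
-- with x · q ≤ y, that q ≤ x → (x · q) = x → ((x · q) ∧ y) ≤ x → y.

open import Data.Nat using (ℕ; zero; suc)
open import Data.Product using (_,_; proj₁; proj₂)
open import Relation.Binary.PropositionalEquality
  using (_≡_; sym; trans; cong; cong₂; subst; isEquivalence)
open import Algebra.Lattice.Bundles using (Lattice)
open import Algebra.Lattice.Structures using (IsLattice; module IsLattice)
open import Algebra.Structures using (IsCommutativeMonoid; module IsCommutativeMonoid)
import Algebra.Lattice.Properties.Lattice as LatticeProperties
open import Relation.Binary.Bundles using (module Poset)

open import Defs

module MeetOrder (A : Alg) (isLattice : IsLattice _≡_ (Alg._⊔_ A) (Alg._⊓_ A)) where
  open Alg A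

  lattice : Lattice _ _
  lattice = record { isLattice = isLattice }

  open LatticeProperties lattice using (∧-idem; poset)
  open Poset poset using () renaming (trans to ≤′-trans; antisym to ≤′-antisym)
  open IsLattice isLattice using (∧-assoc)

  -- Defs orders by a ⊓ b ≡ a, the library's left natural order by a ≡ a ⊓ b.
  ≤-refl : ∀ {a} → _≤_ A a a
  ≤-refl = ∧-idem _

  ≤-trans : ∀ {a b c} → _≤_ A a b → _≤_ A b c → _≤_ A a c
  ≤-trans p q = sym (≤′-trans (sym p) (sym q))

  ≤-antisym : ∀ {a b} → _≤_ A a b → _≤_ A b a → a ≡ b
  ≤-antisym p q = ≤′-antisym (sym p) (sym q)

  ⊓-lowerʳ : ∀ a b → _≤_ A (a ⊓ b) b
  ⊓-lowerʳ a b = trans (∧-assoc a b b) (cong (a ⊓_) (∧-idem b))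

X Y Z : Term
X = var 0
Y = var 1
Z = var 2

σₜ : Term → Term
σₜ t = eₜ →ₜ t

-- An inequation s ≤ t is recorded as the equation s ∧ t ≈ s.
data SrlAxiom : Term → Term → Set where
  ∨-comm       : SrlAxiom (X ∨ₜ Y) (Y ∨ₜ X)
  ∨-assoc      : SrlAxiom ((X ∨ₜ Y) ∨ₜ Z) (X ∨ₜ (Y ∨ₜ Z))
  ∧-comm       : SrlAxiom (X ∧ₜ Y) (Y ∧ₜ X)
  ∧-assoc      : SrlAxiom ((X ∧ₜ Y) ∧ₜ Z) (X ∧ₜ (Y ∧ₜ Z))
  ∨-absorbs-∧  : SrlAxiom (X ∨ₜ (X ∧ₜ Y)) X
  ∧-absorbs-∨  : SrlAxiom (X ∧ₜ (X ∨ₜ Y)) X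
  ·-assoc      : SrlAxiom ((X ·ₜ Y) ·ₜ Z) (X ·ₜ (Y ·ₜ Z))
  ·-identityˡ  : SrlAxiom (eₜ ·ₜ X) X
  ·-identityʳ  : SrlAxiom (X ·ₜ eₜ) X
  ·-comm       : SrlAxiom (X ·ₜ Y) (Y ·ₜ X)
  ·-distribʳ-∨ : SrlAxiom ((X ∨ₜ Y) ·ₜ Z) ((X ·ₜ Z) ∨ₜ (Y ·ₜ Z))
  σ-fixes-⇒    : SrlAxiom (σₜ (X →ₜ Y)) (X →ₜ Y)
  ·-⇒-≤        : SrlAxiom ((X ·ₜ (X →ₜ Y)) ∧ₜ Y) (X ·ₜ (X →ₜ Y))
  σ-≤-⇒·       : SrlAxiom (σₜ Z ∧ₜ (X →ₜ (X ·ₜ σₜ Z))) (σₜ Z)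
  ⇒-monoʳ-∧    : SrlAxiom ((X →ₜ (Y ∧ₜ Z)) ∧ₜ (X →ₜ Z)) (X →ₜ (Y ∧ₜ Z))
  σ-fixes-∧    : SrlAxiom (σₜ (σₜ X ∧ₜ σₜ Y)) (σₜ X ∧ₜ σₜ Y)
  σ-fixes-∨    : SrlAxiom (σₜ (σₜ X ∨ₜ σₜ Y)) (σₜ X ∨ₜ σₜ Y)
  σ-fixes-·    : SrlAxiom (σₜ (σₜ X ·ₜ σₜ Y)) (σₜ X ·ₜ σₜ Y)
  σ-fixes-e    : SrlAxiom (σₜ eₜ) eₜ

module SrlMonoidSatisfiesAxioms
  (A : Alg) (isCommLMonoid : IsCommLMonoid A) (Q : Alg.Carrier A → Set)
  (isSubalgebra : IsSubalgebra A Q) (isMaxResidual : ∀ a b → IsMaxResidual A Q a b)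
  where
  open Alg A
  open IsCommLMonoid isCommLMonoid
  open IsSubalgebra isSubalgebra
  open MeetOrder A isLattice
  module L = IsLattice isLattice
  module M = IsCommutativeMonoid isCommMonoid

  a⇒b∈Q : ∀ a b → Q (a ⇒ b)
  a⇒b∈Q a b = proj₁ (isMaxResidual a b)

  a·[a⇒b]≤b : ∀ a b → _≤_ A (a · (a ⇒ b)) b
  a·[a⇒b]≤b a b = proj₁ (proj₂ (isMaxResidual a b))

  ⇒-maximal : ∀ {a b q} → Q q → _≤_ A (a · q) b → _≤_ A q (a ⇒ b)
  ⇒-maximal {a} {b} {q} = proj₂ (proj₂ (isMaxResidual a b)) q

  σ-fixes-Q : ∀ {q} → Q q → (e ⇒ q) ≡ q
  σ-fixes-Q {q} q∈Q = ≤-antisym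
    (subst (λ w → _≤_ A w q) (M.identityˡ (e ⇒ q)) (a·[a⇒b]≤b e q))
    (⇒-maximal q∈Q (subst (λ w → _≤_ A w q) (sym (M.identityˡ q)) ≤-refl))

  satisfies : Satisfies A SrlAxiom
  satisfies _ _ ∨-comm ρ = L.∨-comm _ _
  satisfies _ _ ∨-assoc ρ = L.∨-assoc _ _ _
  satisfies _ _ ∧-comm ρ = L.∧-comm _ _
  satisfies _ _ ∧-assoc ρ = L.∧-assoc _ _ _
  satisfies _ _ ∨-absorbs-∧ ρ = L.∨-absorbs-∧ _ _
  satisfies _ _ ∧-absorbs-∨ ρ = L.∧-absorbs-∨ _ _
  satisfies _ _ ·-assoc ρ = M.assoc _ _ _
  satisfies _ _ ·-identityˡ ρ = M.identityˡ _
  satisfies _ _ ·-identityʳ ρ = M.identityʳ _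
  satisfies _ _ ·-comm ρ = M.comm _ _
  satisfies _ _ ·-distribʳ-∨ ρ = distrib _ _ _
  satisfies _ _ σ-fixes-⇒ ρ = σ-fixes-Q (a⇒b∈Q _ _)
  satisfies _ _ ·-⇒-≤ ρ = a·[a⇒b]≤b _ _
  satisfies _ _ σ-≤-⇒· ρ = ⇒-maximal (a⇒b∈Q e (ρ 2)) ≤-refl
  satisfies _ _ ⇒-monoʳ-∧ ρ = ⇒-maximal (a⇒b∈Q _ _) (≤-trans (a·[a⇒b]≤b _ _) (⊓-lowerʳ _ _))
  satisfies _ _ σ-fixes-∧ ρ = σ-fixes-Q (⊓-closed (a⇒b∈Q _ _) (a⇒b∈Q _ _))
  satisfies _ _ σ-fixes-∨ ρ = σ-fixes-Q (⊔-closed (a⇒b∈Q _ _) (a⇒b∈Q _ _))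
  satisfies _ _ σ-fixes-· ρ = σ-fixes-Q (·-closed (a⇒b∈Q _ _) (a⇒b∈Q _ _))
  satisfies _ _ σ-fixes-e ρ = σ-fixes-Q e-closed

srl⇒satisfies : ∀ A → IsSrlMonoid A → Satisfies A SrlAxiom
srl⇒satisfies A (isCommLMonoid , Q , isSubalgebra , isMaxResidual) =
  SrlMonoidSatisfiesAxioms.satisfies A isCommLMonoid Q isSubalgebra isMaxResidual

assign : {C : Set} → C → C → C → ℕ → C
assign a b c zero = a
assign a b c (suc zero) = b
assign a b c (suc (suc _)) = c

module SatisfierIsSrlMonoid (A : Alg) (satisfies : Satisfies A SrlAxiom) where
  open Alg A

  holds : ∀ {s t} → SrlAxiom s t → ∀ a b c → ⟦ s ⟧ A (assign a b c) ≡ ⟦ t ⟧ A (assign a b c)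
  holds {s} {t} axiom a b c = satisfies s t axiom (assign a b c)

  isLattice : IsLattice _≡_ _⊔_ _⊓_
  isLattice = record
    { isEquivalence = isEquivalence
    ; ∨-comm        = λ a b → holds ∨-comm a b a
    ; ∨-assoc       = holds ∨-assoc
    ; ∨-cong        = cong₂ _⊔_
    ; ∧-comm        = λ a b → holds ∧-comm a b a
    ; ∧-assoc       = holds ∧-assoc
    ; ∧-cong        = cong₂ _⊓_
    ; absorptive    = (λ a b → holds ∨-absorbs-∧ a b a) , (λ a b → holds ∧-absorbs-∨ a b a)
    }

  isCommMonoid : IsCommutativeMonoid _≡_ _·_ e
  isCommMonoid = record
    { isMonoid = record
      { isSemigroup = record
        { isMagma = record { isEquivalence = isEquivalence ; ∙-cong = cong₂ _·_ }
        ; assoc   = holds ·-assoc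
        }
      ; identity = (λ a → holds ·-identityˡ a a a) , (λ a → holds ·-identityʳ a a a)
      }
    ; comm = λ a b → holds ·-comm a b a
    }

  isCommLMonoid : IsCommLMonoid A
  isCommLMonoid = record
    { isLattice    = isLattice
    ; isCommMonoid = isCommMonoid
    ; distrib      = holds ·-distribʳ-∨
    }

  open MeetOrder A isLattice

  σ-Fixed : Carrier → Set
  σ-Fixed a = (e ⇒ a) ≡ a

  σ-Fixed-closed : (_∙_ : Carrier → Carrier → Carrier) →
    (∀ a b → (e ⇒ ((e ⇒ a) ∙ (e ⇒ b))) ≡ ((e ⇒ a) ∙ (e ⇒ b))) →
    ∀ {a b} → σ-Fixed a → σ-Fixed b → σ-Fixed (a ∙ b)
  σ-Fixed-closed _∙_ σ-fixes-∙ {a} {b} fixed-a fixed-b =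
    subst σ-Fixed (cong₂ _∙_ fixed-a fixed-b) (σ-fixes-∙ a b)

  σ-Fixed-isSubalgebra : IsSubalgebra A σ-Fixed
  σ-Fixed-isSubalgebra = record
    { ⊓-closed = σ-Fixed-closed _⊓_ (λ a b → holds σ-fixes-∧ a b a)
    ; ⊔-closed = σ-Fixed-closed _⊔_ (λ a b → holds σ-fixes-∨ a b a)
    ; ·-closed = σ-Fixed-closed _·_ (λ a b → holds σ-fixes-· a b a)
    ; e-closed = holds σ-fixes-e e e e
    }

  ⇒-maximal : ∀ {a b q} → σ-Fixed q → _≤_ A (a · q) b → _≤_ A q (a ⇒ b)
  ⇒-maximal {a} {b} {q} fixed-q a·q≤b = ≤-trans q≤a⇒a·q a⇒a·q≤a⇒b
    where
    q≤a⇒a·q : _≤_ A q (a ⇒ (a · q))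
    q≤a⇒a·q = subst (λ w → _≤_ A w (a ⇒ (a · w))) fixed-q (holds σ-≤-⇒· a a q)

    a⇒a·q≤a⇒b : _≤_ A (a ⇒ (a · q)) (a ⇒ b)
    a⇒a·q≤a⇒b = subst (λ w → _≤_ A (a ⇒ w) (a ⇒ b)) a·q≤b (holds ⇒-monoʳ-∧ a (a · q) b)

  isMaxResidual : ∀ a b → IsMaxResidual A σ-Fixed a b
  isMaxResidual a b = holds σ-fixes-⇒ a b a , holds ·-⇒-≤ a b a , λ q → ⇒-maximal

  isSrlMonoid : IsSrlMonoid A
  isSrlMonoid = isCommLMonoid , σ-Fixed , σ-Fixed-isSubalgebra , isMaxResidual

satisfies⇒srl : ∀ A → Satisfies A SrlAxiom → IsSrlMonoid A
satisfies⇒srl = SatisfierIsSrlMonoid.isSrlMonoid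

corollary2p6 : IsVariety IsSrlMonoid
corollary2p6 = SrlAxiom , λ A → srl⇒satisfies A , satisfies⇒srl A
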